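{- Let $t$ be a binary tree whose nodes are partitioned into micro trees by the Farzan–Munro algorithm. If for a micro tree $\mu$ the positions in $\mathrm{BP}_\mathrm{b}(t)$ of the parentheses of its nodes form two maximal intervals of consecutive positions, then the right one of these intervals (the non-empty right chunk of $\mu$) begins with a closing parenthesis.
   Context: A binary tree is a rooted tree where each node has a left and a right child slot, each possibly empty. $\mathrm{BP}_\mathrm{b}(t)=\epsilon$ if $t$ is empty and otherwise $\texttt{(}\cdot \mathrm{BP}_\mathrm{b}(t_l)\cdot \texttt{)}\cdot \mathrm{BP}_\mathrm{b}(t_r)$, with $t_l,t_r$ the left and right subtrees of the root; node $v$ corresponds to the matching pair inserted when expanding the subtree rooted at $v$. The Farzan–Munro algorithm partitions the nodes of a binary tree into disjoint micro trees, each a connected set of nodes rooted at its topmost node; it is known that contracting each micro tree into a single node yields a binary tree and that any micro tree with two child micro trees (micro trees whose root's parent lies in it) consists of a single node. -}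

module Defs where

open import Data.Nat using (ℕ; zero; suc)
open import Data.List using (List; []; _∷_; _++_; map)
open import Data.Maybe using (Maybe; just; nothing)
open import Data.Product using (_×_; _,_; ∃; Σ; map₂)
open import Data.Sum using (_⊎_)
open import Relation.Binary.PropositionalEquality using (_≡_)

data Tree : Set where
  empty : Tree
  node  : Tree → Tree → Tree

data Node : Tree → Set where
  here : ∀ {l r} → Node (node l r)
  inl  : ∀ {l r} → Node l → Node (node l r)
  inr  : ∀ {l r} → Node r → Node (node l r)

data Child : {t : Tree} → Node t → Node t → Set where
  lc  : ∀ {ll lr r} → Child {node (node ll lr) r} here (inl here)
  rc  : ∀ {l rl rr} → Child {node l (node rl rr)} here (inr here)
  inL : ∀ {l r} {p c : Node l} → Child p c → Child {node l r} (inl p) (inl c)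
  inR : ∀ {l r} {p c : Node r} → Child p c → Child {node l r} (inr p) (inr c)

data Paren : Set where
  opn cls : Paren

-- BP_b(t), each parenthesis tagged with the node it belongs to:
-- BP_b(empty) = ε,  BP_b(node l r) = ( · BP_b(l) · ) · BP_b(r).
BP : (t : Tree) → List (Paren × Node t)
BP empty      = []
BP (node l r) =
  (opn , here) ∷ map (map₂ inl) (BP l) ++ (cls , here) ∷ map (map₂ inr) (BP r)

nth : {A : Set} → List A → ℕ → Maybe A
nth []       _       = nothing
nth (x ∷ xs) zero    = just x
nth (x ∷ xs) (suc i) = nth xs i

Connected : {t : Tree} → (Node t → Set) → Set
Connected {t} S =
  Σ (Node t) λ r → S r × (∀ v → S v → (v ≡ r) ⊎ (∃ λ p → Child p v × S p))

-- A partition of the nodes of t into micro trees, given by a labelling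
-- f : Node t → M (two nodes are in the same micro tree iff same label),
-- such that every (non-empty) class is a connected micro tree.
IsMicroTreePartition : {t : Tree} {M : Set} → (Node t → M) → Set
IsMicroTreePartition {t} f = ∀ (v : Node t) → Connected (λ u → f u ≡ f v)

InMicro : {t : Tree} {M : Set} → (Node t → M) → M → ℕ → Set
InMicro {t} f m i = ∃ λ (p : Paren) → ∃ λ (v : Node t) → nth (BP t) i ≡ just (p , v) × f v ≡ m

{-# OPTIONS --safe #-}
-- Suppose position c of BP_b(t) held an opening parenthesis, that of a node v of μ.
-- The topmost node of μ opens no later than position a < c, so v is not the root of μ
-- and its parent lies in μ. Whether v is a left or a right child, the parenthesis
-- just before v's opening one belongs to its parent, so position c - 1 lies in μ;
-- but c - 1 falls strictly between the two chunks.
module Submission where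

open import Defs
open import Data.Nat using (ℕ; _≤_; _<_; _+_; zero; suc; z≤n; s≤s)
open import Data.Nat.Properties
  using (≤-refl; ≤-trans; ≤-<-trans; <⇒≤; <-irrefl; n≮n; ≤-pred; m≤m+n; m+1+n≰m; +-monoʳ-≤; +-suc)
open import Data.Nat.Induction using (<-wellFounded)
open import Data.Product using (_×_; _,_; ∃; proj₁; proj₂; map₂)
open import Data.Sum using (_⊎_; inj₁; inj₂)
open import Data.Maybe using (just)
open import Data.List using (List; []; _∷_; _++_; map; length)
open import Data.List.Properties using (length-map)
open import Data.Empty using (⊥-elim)
open import Function.Bundles using (_⇔_; Equivalence)
open import Induction.WellFounded using (Acc; acc)
open import Relation.Binary.PropositionalEquality using (_≡_; refl; sym; trans; cong; subst)

module _ {A : Set} where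

  nth-++ˡ : (xs ys : List A) (i : ℕ) {z : A} → nth xs i ≡ just z → nth (xs ++ ys) i ≡ just z
  nth-++ˡ (x ∷ xs) ys zero    e = e
  nth-++ˡ (x ∷ xs) ys (suc i) e = nth-++ˡ xs ys i e

  nth-++ʳ : (xs ys : List A) (k : ℕ) → nth (xs ++ ys) (length xs + k) ≡ nth ys k
  nth-++ʳ []       ys k = refl
  nth-++ʳ (x ∷ xs) ys k = nth-++ʳ xs ys k

  nth-++⁻ : (xs ys : List A) (i : ℕ) {z : A} → nth (xs ++ ys) i ≡ just z →
            nth xs i ≡ just z ⊎ ∃ λ k → i ≡ length xs + k × nth ys k ≡ just z
  nth-++⁻ []       ys i       e = inj₂ (i , refl , e)
  nth-++⁻ (x ∷ xs) ys zero    e = inj₁ e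
  nth-++⁻ (x ∷ xs) ys (suc i) e with nth-++⁻ xs ys i e
  ... | inj₁ h              = inj₁ h
  ... | inj₂ (k , refl , h) = inj₂ (k , refl , h)

  module _ {B : Set} (g : A → B) where

    nth-map : (xs : List A) (i : ℕ) {z : A} → nth xs i ≡ just z → nth (map g xs) i ≡ just (g z)
    nth-map (x ∷ xs) zero    refl = refl
    nth-map (x ∷ xs) (suc i) e    = nth-map xs i e

    nth-map⁻ : (xs : List A) (i : ℕ) {y : B} → nth (map g xs) i ≡ just y →
               ∃ λ x → nth xs i ≡ just x × g x ≡ y
    nth-map⁻ (x ∷ xs) zero    refl = x , refl , refl
    nth-map⁻ (x ∷ xs) (suc i) e    = nth-map⁻ xs i e

openPos : {t : Tree} → Node t → ℕ
openPos here        = 0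
openPos (inl u)     = suc (openPos u)
openPos (inr {l} u) = suc (length (BP l) + suc (openPos u))

module _ {l r : Tree} where

  private
    BP-left : List (Paren × Node (node l r))
    BP-left = map (map₂ inl) (BP l)

    BP-close-right : List (Paren × Node (node l r))
    BP-close-right = (cls , here) ∷ map (map₂ inr) (BP r)

  nth-BP-inl : (i : ℕ) {p : Paren} {u : Node l} → nth (BP l) i ≡ just (p , u) →
               nth (BP (node l r)) (suc i) ≡ just (p , inl u)
  nth-BP-inl i h = nth-++ˡ BP-left BP-close-right i (nth-map (map₂ inl) (BP l) i h)

  nth-BP-after-left : (k : ℕ) → nth (BP (node l r)) (suc (length (BP l) + k)) ≡ nth BP-close-right k
  nth-BP-after-left k =
    subst (λ n → nth (BP-left ++ BP-close-right) (n + k) ≡ nth BP-close-right k)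
          (length-map (map₂ inl) (BP l))
          (nth-++ʳ BP-left BP-close-right k)

  nth-BP-inr : (i : ℕ) {p : Paren} {u : Node r} → nth (BP r) i ≡ just (p , u) →
               nth (BP (node l r)) (suc (length (BP l) + suc i)) ≡ just (p , inr u)
  nth-BP-inr i h = trans (nth-BP-after-left (suc i)) (nth-map (map₂ inr) (BP r) i h)

nth-BP⇒openPos≤ : (t : Tree) (i : ℕ) {p : Paren} {u : Node t} → nth (BP t) i ≡ just (p , u) →
                  openPos u ≤ i × (p ≡ opn → i ≡ openPos u)
nth-BP⇒openPos≤ (node l r) zero    refl = z≤n , λ _ → refl
nth-BP⇒openPos≤ (node l r) (suc j) e with nth-++⁻ (map (map₂ inl) (BP l)) _ j e
... | inj₁ h with nth-map⁻ (map₂ inl) (BP l) j h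
...   | _ , h′ , refl with nth-BP⇒openPos≤ l j h′
...     | le , opn⇒≡ = s≤s le , λ q → cong suc (opn⇒≡ q)
nth-BP⇒openPos≤ (node l r) (suc j) e | inj₂ (zero , refl , refl) = z≤n , λ ()
nth-BP⇒openPos≤ (node l r) (suc j) e | inj₂ (suc k , refl , h) with nth-map⁻ (map₂ inr) (BP r) k h
... | _ , h′ , refl with nth-BP⇒openPos≤ r k h′
...   | le , opn⇒≡ rewrite length-map (map₂ (inl {l} {r})) (BP l) =
  s≤s (+-monoʳ-≤ (length (BP l)) (s≤s le)) ,
  λ q → cong (λ n → suc (length (BP l) + suc n)) (opn⇒≡ q)

parent-just-before : {t : Tree} {p v : Node t} → Child p v →
                     ∃ λ j → openPos v ≡ suc j × ∃ λ q → nth (BP t) j ≡ just (q , p)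
parent-just-before lc = 0 , refl , opn , refl
parent-just-before (rc {l}) = suc (length (BP l) + 0) , cong suc (+-suc _ 0) , cls , nth-BP-after-left 0
parent-just-before {node l r} (inL ch) with parent-just-before ch
... | j , e , q , h = suc j , cong suc e , q , nth-BP-inl j h
parent-just-before {node l r} (inR ch) with parent-just-before ch
... | j , e , q , h =
  suc (length (BP l) + suc j) ,
  cong suc (trans (cong (λ n → length (BP l) + suc n) e) (+-suc (length (BP l)) (suc j))) ,
  q , nth-BP-inr j h

openPos-parent< : {t : Tree} {p v : Node t} → Child p v → openPos p < openPos v
openPos-parent< {t} ch with parent-just-before ch
... | j , e , q , h with nth-BP⇒openPos≤ t j h
...   | le , _ = subst (openPos _ <_) (sym e) (s≤s le)

openPos-root≤ : {t : Tree} {S : Node t → Set} ((r , _ , up) : Connected S) →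
                ∀ u → S u → openPos r ≤ openPos u
openPos-root≤ {S = S} (r , _ , up) u Su = go u Su (<-wellFounded (openPos u))
  where
  go : ∀ u → S u → Acc _<_ (openPos u) → openPos r ≤ openPos u
  go u Su (acc rec) with up u Su
  ... | inj₁ refl          = ≤-refl
  ... | inj₂ (p , ch , Sp) =
    <⇒≤ (≤-<-trans (go p Sp (rec (openPos-parent< ch))) (openPos-parent< ch))

InMicro-before-opn : {t : Tree} {M : Set} {f : Node t → M} → IsMicroTreePartition f →
                     ∀ {c i v} → nth (BP t) c ≡ just (opn , v) → InMicro f (f v) i → i < c →
                     ∃ λ j → c ≡ suc j × InMicro f (f v) j
InMicro-before-opn {t} part {c} {i} {v} ev (_ , w , ew , fw) i<c
  with part v | proj₂ (nth-BP⇒openPos≤ t c ev) refl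
... | micro@(r , _ , up) | c≡ with up v refl
...   | inj₁ refl = ⊥-elim (<-irrefl (sym c≡) root<c)
  where
  root<c : openPos r < c
  root<c = ≤-<-trans (openPos-root≤ micro w fw) (≤-<-trans (proj₁ (nth-BP⇒openPos≤ t i ew)) i<c)
...   | inj₂ (p , ch , fp) with parent-just-before ch
...     | j , e , q , h = j , trans c≡ e , q , p , h , fp

lemma14 : (t : Tree) {M : Set} (f : Node t → M) → IsMicroTreePartition f →
          (m : M) (a b c d : ℕ) → a ≤ b → b + 1 < c → c ≤ d →
          (∀ i → InMicro f m i ⇔ ((a ≤ i × i ≤ b) ⊎ (c ≤ i × i ≤ d))) →
          ∃ λ (v : Node t) → nth (BP t) c ≡ just (cls , v)
lemma14 t f part m a b c d a≤b b+1<c c≤d chunks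
  with Equivalence.from (chunks c) (inj₂ (≤-refl , c≤d))
... | cls , v , ev , _    = v , ev
... | opn , v , ev , refl with InMicro-before-opn part ev a∈μ a<c
  where
  a∈μ : InMicro f m a
  a∈μ = Equivalence.from (chunks a) (inj₁ (≤-refl , a≤b))
  a<c : a < c
  a<c = ≤-<-trans a≤b (≤-<-trans (m≤m+n b 1) b+1<c)
...   | j , refl , j∈μ with Equivalence.to (chunks j) j∈μ
...     | inj₁ (_ , j≤b) = ⊥-elim (m+1+n≰m b (≤-trans (≤-pred b+1<c) j≤b))
...     | inj₂ (c≤j , _) = ⊥-elim (n≮n j c≤j)
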